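{- Let $S\le T$ be subsets of $[n]$ in the type $C_n$ Gale order and let $\ell\in[n]$ not be a loop of $\Delta[S,T]$. Let $A=S\setminus\{\ell\}$ if $\ell\in S$, and $A=S\setminus\{\max\{i\in S: i<\ell\}\}$ otherwise. Let $B=T\setminus\{\ell\}$ if $\ell\in T$, and $B=T\setminus\{\min\{i\in T: \ell<i\}\}$ otherwise. (If the set whose maximum or minimum is taken is empty, nothing is removed.) Then the contraction $\Delta[S,T]/\ell$ is the lattice path delta matroid $\Delta[A,B]$ on ground set $[n]\setminus\{\ell\}$ (with its induced order).
   Context: For a finite totally ordered set $E$, the type $C$ Gale order on subsets of $E$: $A=\{a_1<\dots<a_j\}\le B=\{b_1<\dots<b_k\}$ iff $j\le k$ and $a_{j-i+1}\le b_{k-i+1}$ for all $i\in[j]$; for $S\le T$, $\Delta[S,T]$ on $E$ is the delta matroid with feasible sets $\{R\subseteq E: S\le R\le T\}$. A loop is an element in no feasible set. The contraction $\Delta/\ell$ is the delta matroid on $[n]\setminus\{\ell\}$ with feasible sets $\{B\setminus\{\ell\}: B \text{ feasible}, \ell\in B\}$. -}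

module Defs where

open import Data.Nat using (ℕ)
open import Data.Bool using (Bool; true; false; if_then_else_)
open import Data.Fin using (Fin; _≤_; _<?_)
open import Data.Fin.Subset using (Subset; _∈_; _∉_; _-_)
open import Data.List using (List; []; _∷_; filter; reverse; head)
open import Data.Vec using (lookup; toList)
open import Data.Fin.Base using ()
open import Data.Maybe using (Maybe; just; nothing)
open import Data.Product using (Σ; _×_)
open import Data.Unit using (⊤)
open import Data.Empty using (⊥)
open import Relation.Binary.PropositionalEquality using (_≡_)

private
  variable
    n : ℕ

allFinAsc : (n : ℕ) → List (Fin n)
allFinAsc n = toList (Data.Vec.allFin n)

elemsAsc : Subset n → List (Fin n)
elemsAsc {n} S = Data.List.filter (λ i → Data.Bool._≟_ (lookup S i) true) (allFinAsc n)

elemsDesc : Subset n → List (Fin n)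
elemsDesc S = reverse (elemsAsc S)

-- Given the decreasing lists (aⱼ, …, a₁) and (bₖ, …, b₁), this says
-- j ≤ k and a_{j-i+1} ≤ b_{k-i+1} for all i ∈ [j].
GaleDesc : List (Fin n) → List (Fin n) → Set
GaleDesc []       _        = ⊤
GaleDesc (a ∷ as) []       = ⊥
GaleDesc (a ∷ as) (b ∷ bs) = (a ≤ b) × GaleDesc as bs

_≤G_ : Subset n → Subset n → Set
A ≤G B = GaleDesc (elemsDesc A) (elemsDesc B)

Feasible : Subset n → Subset n → Subset n → Set
Feasible S T R = (S ≤G R) × (R ≤G T)

IsLoop : Subset n → Subset n → Fin n → Set
IsLoop {n} S T ℓ = (R : Subset n) → Feasible S T R → ℓ ∉ R

-- feasible sets of the contraction Δ[S,T]/ℓ (as subsets of [n] avoiding ℓ)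
ContractionFeasible : Subset n → Subset n → Fin n → Subset n → Set
ContractionFeasible {n} S T ℓ X =
  Σ (Subset n) λ R → Feasible S T R × (ℓ ∈ R) × (X ≡ R - ℓ)

maxBelow : Subset n → Fin n → Maybe (Fin n)
maxBelow S ℓ = head (filter (λ i → i <? ℓ) (elemsDesc S))

minAbove : Subset n → Fin n → Maybe (Fin n)
minAbove T ℓ = head (filter (λ i → ℓ <? i) (elemsAsc T))

removeMaybe : Subset n → Maybe (Fin n) → Subset n
removeMaybe S (just i) = S - i
removeMaybe S nothing  = S

lowerSet : Subset n → Fin n → Subset n
lowerSet S ℓ = if lookup S ℓ then S - ℓ else removeMaybe S (maxBelow S ℓ)

upperSet : Subset n → Fin n → Subset n
upperSet T ℓ = if lookup T ℓ then T - ℓ else removeMaybe T (minAbove T ℓ)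

-- Compare subsets through their tail counts N_R(t) = #{i ∈ R : t ≤ i}: R ≤ R' in the Gale
-- order exactly when N_R ≤ N_R' pointwise. If R = X ∪ {ℓ} with ℓ ∉ X, then N_R = N_X + 1 on
-- t ≤ ℓ and N_R = N_X above ℓ. Removing from S its largest element m ≤ ℓ (if any) lowers N_S by one on
-- t ≤ m and leaves it unchanged on (m, ℓ], where S has no elements; this gives S ≤ R ⇔ A ≤ X.
-- Symmetrically, removing from T the least element m ≥ ℓ gives R ≤ T ⇔ X ≤ B. Such an m exists
-- because ℓ is not a loop: if T had nothing at or above ℓ, then N_T(ℓ) = 0 < N_R(ℓ) for every
-- R ∋ ℓ. Finally A ≤ R ∖ ℓ ≤ B for any feasible R ∋ ℓ; since N_A ≤ N_B is a pointwise
-- comparison of natural numbers, knowing only that such an R is not impossible suffices.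
module Submission where

open import Defs
open import Data.Nat as ℕ using (ℕ; zero; suc; z≤n; s≤s; s≤s⁻¹; _≤?_)
open import Data.Nat.Properties
  using (≤-refl; ≤-trans; ≤-reflexive; n≤1+n; <⇒≤; ≰⇒>; <⇒≱; <-trans; <-≤-trans; ≤-<-trans; module ≤-Reasoning)
open import Data.Bool using (true; false; if_then_else_) renaming (_≟_ to _≟ᵇ_)
open import Data.Fin as F using (Fin; toℕ)
import Data.Fin.Properties as F
open import Data.Fin.Subset using (Subset; _∈_; _∉_; _-_)
open import Data.Fin.Subset.Properties using (p─⊥≡p)
open import Data.List using (List; []; _∷_; length; map; filter; reverse; head)
open import Data.List.Properties using (filter-accept; filter-reject; filter-none; unfold-reverse)
open import Data.List.Membership.Propositional using () renaming (_∈_ to _∈ₗ_)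
open import Data.List.Membership.Propositional.Properties using (∈-filter⁺; ∈-filter⁻)
open import Data.List.Relation.Binary.Permutation.Propositional.Properties using (↭-length; filter-↭; ↭-reverse)
open import Data.List.Relation.Unary.All as All using (All; []; _∷_)
import Data.List.Relation.Unary.All.Properties as All
open import Data.List.Relation.Unary.AllPairs as AllPairs using (AllPairs; []; _∷_)
import Data.List.Relation.Unary.AllPairs.Properties as AllPairs
open import Data.List.Relation.Unary.Any using (here; there)
import Data.List.Relation.Unary.Any.Properties as Any
open import Data.Maybe using (just; nothing)
open import Data.Vec as Vec using (_∷_; lookup; toList; _[_]≔_)
open import Data.Vec.Properties using (allFin-map; toList-map; []=⇒lookup; lookup⇒[]=; []≔-updates)
open import Data.Vec.Membership.Propositional.Properties using (∈-allFin⁺; ∈-toList⁺)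
open import Data.Product using (_×_; _,_; proj₁; proj₂)
open import Data.Product.Function.NonDependent.Propositional using (_×-⇔_)
open import Data.Sum using (_⊎_; inj₁; inj₂)
open import Data.Unit using (tt)
open import Function using (_∘_; flip)
open import Function.Bundles using (_⇔_; mk⇔; Equivalence)
import Function.Properties.Equivalence as ⇔
open import Relation.Binary using (tri<; tri≈; tri>)
open import Relation.Nullary using (¬_; yes; no; contradiction)
open import Relation.Nullary.Decidable using (decidable-stable)
open import Relation.Unary using (Decidable)
open import Relation.Binary.PropositionalEquality

private variable n : ℕ

AllPairs-reverse : ∀ {A : Set} {R : A → A → Set} {xs : List A} →
  AllPairs R xs → AllPairs (flip R) (reverse xs)
AllPairs-reverse [] = []
AllPairs-reverse {xs = x ∷ xs} (x~xs ∷ xs!) rewrite unfold-reverse x xs =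
  AllPairs.++⁺ (AllPairs-reverse xs!) ([] ∷ [])
    (All.tabulate (λ y∈ → All.lookup x~xs (Any.reverse⁻ y∈) ∷ []))

filter-map : ∀ {A B : Set} {P : B → Set} (P? : Decidable P) (f : A → B) (xs : List A) →
  filter P? (map f xs) ≡ map f (filter (P? ∘ f) xs)
filter-map P? f [] = refl
filter-map P? f (x ∷ xs) with P? (f x)
... | yes _ = cong (f x ∷_) (filter-map P? f xs)
... | no  _ = filter-map P? f xs

module _ {A : Set} {R : A → A → Set} where

  head-just : ∀ {xs : List A} {m} → AllPairs R xs → head xs ≡ just m →
    m ∈ₗ xs × (∀ {i} → i ∈ₗ xs → i ≡ m ⊎ R m i)
  head-just (m~xs ∷ _) refl = here refl , λ { (here eq) → inj₁ eq ; (there i∈) → inj₂ (All.lookup m~xs i∈) }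

  head-filter-just : ∀ {P : A → Set} (P? : Decidable P) {xs m} → AllPairs R xs →
    head (filter P? xs) ≡ just m → m ∈ₗ xs × P m × (∀ {i} → i ∈ₗ xs → P i → i ≡ m ⊎ R m i)
  head-filter-just P? {xs} sorted eq with head-just (AllPairs.filter⁺ P? sorted) eq
  ... | m∈ , least with ∈-filter⁻ P? {xs = xs} m∈
  ...   | m∈xs , Pm = m∈xs , Pm , λ i∈ Pi → least (∈-filter⁺ P? i∈ Pi)

head-nothing : ∀ {A : Set} {xs : List A} {i} → head xs ≡ nothing → ¬ i ∈ₗ xs
head-nothing {xs = []} _ ()
head-nothing {xs = _ ∷ _} ()

head-filter-nothing : ∀ {A : Set} {P : A → Set} (P? : Decidable P) {xs : List A} {i} →
  head (filter P? xs) ≡ nothing → i ∈ₗ xs → ¬ P i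
head-filter-nothing P? eq i∈ Pi = head-nothing eq (∈-filter⁺ P? i∈ Pi)

countAtLeast : ℕ → List (Fin n) → ℕ
countAtLeast t xs = length (filter (λ x → t ≤? toℕ x) xs)

countAtLeast-accept : ∀ {t} {x : Fin n} xs → t ℕ.≤ toℕ x → countAtLeast t (x ∷ xs) ≡ suc (countAtLeast t xs)
countAtLeast-accept {t = t} xs t≤x = cong length (filter-accept (λ x → t ≤? toℕ x) {xs = xs} t≤x)

countAtLeast-reject : ∀ {t} {x : Fin n} xs → ¬ t ℕ.≤ toℕ x → countAtLeast t (x ∷ xs) ≡ countAtLeast t xs
countAtLeast-reject {t = t} xs t≰x = cong length (filter-reject (λ x → t ≤? toℕ x) {xs = xs} t≰x)

countAtLeast-below : ∀ {t} {xs : List (Fin n)} → All (λ x → toℕ x ℕ.< t) xs → countAtLeast t xs ≡ 0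
countAtLeast-below {t = t} xs<t = cong length (filter-none (λ x → t ≤? toℕ x) (All.map <⇒≱ xs<t))

countAtLeast-reverse : ∀ t (xs : List (Fin n)) → countAtLeast t (reverse xs) ≡ countAtLeast t xs
countAtLeast-reverse t xs = ↭-length (filter-↭ (λ x → t ≤? toℕ x) (↭-reverse xs))

countAtLeast-zero-map-suc : (xs : List (Fin n)) → countAtLeast 0 (map F.suc xs) ≡ countAtLeast 0 xs
countAtLeast-zero-map-suc [] = refl
countAtLeast-zero-map-suc (x ∷ xs) = cong suc (countAtLeast-zero-map-suc xs)

countAtLeast-map-suc : ∀ t (xs : List (Fin n)) → countAtLeast (suc t) (map F.suc xs) ≡ countAtLeast t xs
countAtLeast-map-suc t [] = refl
countAtLeast-map-suc t (x ∷ xs) with t ≤? toℕ x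
... | yes t≤x = begin
  countAtLeast (suc t) (map F.suc (x ∷ xs)) ≡⟨ countAtLeast-accept (map F.suc xs) (s≤s t≤x) ⟩
  suc (countAtLeast (suc t) (map F.suc xs)) ≡⟨ cong suc (countAtLeast-map-suc t xs) ⟩
  suc (countAtLeast t xs)                   ≡⟨ countAtLeast-accept xs t≤x ⟨
  countAtLeast t (x ∷ xs)                   ∎
  where open ≡-Reasoning
... | no t≰x = begin
  countAtLeast (suc t) (map F.suc (x ∷ xs)) ≡⟨ countAtLeast-reject (map F.suc xs) (t≰x ∘ s≤s⁻¹) ⟩
  countAtLeast (suc t) (map F.suc xs)       ≡⟨ countAtLeast-map-suc t xs ⟩
  countAtLeast t xs                         ≡⟨ countAtLeast-reject xs t≰x ⟨
  countAtLeast t (x ∷ xs)                   ∎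
  where open ≡-Reasoning

Decreasing : List (Fin n) → Set
Decreasing = AllPairs (λ a b → b F.< a)

countAtLeast-past-head : ∀ {t} {a : Fin n} {as} → Decreasing (a ∷ as) → toℕ a ℕ.< t → countAtLeast t (a ∷ as) ≡ 0
countAtLeast-past-head (as<a ∷ _) a<t = countAtLeast-below (a<t ∷ All.map (λ x<a → <-trans x<a a<t) as<a)

GaleDesc⇒countAtLeast-≤ : ∀ {as bs : List (Fin n)} → Decreasing as → GaleDesc as bs →
  ∀ t → countAtLeast t as ℕ.≤ countAtLeast t bs
GaleDesc⇒countAtLeast-≤ {as = []} _ _ t = z≤n
GaleDesc⇒countAtLeast-≤ {as = a ∷ as} {b ∷ bs} as↓@(_ ∷ as↓′) (a≤b , as≤bs) t with t ≤? toℕ a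
... | yes t≤a rewrite countAtLeast-accept as t≤a | countAtLeast-accept bs (≤-trans t≤a a≤b) =
  s≤s (GaleDesc⇒countAtLeast-≤ as↓′ as≤bs t)
... | no t≰a rewrite countAtLeast-past-head as↓ (≰⇒> t≰a) = z≤n

countAtLeast-≤⇒GaleDesc : ∀ {as bs : List (Fin n)} → Decreasing as → Decreasing bs →
  (∀ t → countAtLeast t as ℕ.≤ countAtLeast t bs) → GaleDesc as bs
countAtLeast-≤⇒GaleDesc {as = []} _ _ _ = tt
countAtLeast-≤⇒GaleDesc {as = a ∷ as} {[]} _ _ as≤bs with as≤bs (toℕ a)
... | a∷as≤[] rewrite countAtLeast-accept as (≤-refl {toℕ a}) with a∷as≤[]
... | ()
countAtLeast-≤⇒GaleDesc {as = a ∷ as} {b ∷ bs} as↓@(as<a ∷ as↓′) bs↓@(_ ∷ bs↓′) as≤bs =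
  a≤b , countAtLeast-≤⇒GaleDesc as↓′ bs↓′ tails≤
  where
  a≤b : toℕ a ℕ.≤ toℕ b
  a≤b with toℕ a ≤? toℕ b
  ... | yes a≤b = a≤b
  ... | no a≰b with as≤bs (toℕ a)
  ... | a∷as≤b∷bs rewrite countAtLeast-accept as (≤-refl {toℕ a}) | countAtLeast-past-head bs↓ (≰⇒> a≰b)
    with a∷as≤b∷bs
  ... | ()
  tails≤ : ∀ t → countAtLeast t as ℕ.≤ countAtLeast t bs
  tails≤ t with t ≤? toℕ a
  ... | yes t≤a with as≤bs t
  ... | a∷as≤b∷bs rewrite countAtLeast-accept as t≤a | countAtLeast-accept bs (≤-trans t≤a a≤b) = s≤s⁻¹ a∷as≤b∷bs
  tails≤ t | no t≰a rewrite countAtLeast-below (All.map (λ x<a → <-trans x<a (≰⇒> t≰a)) as<a) = z≤n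

allFinAsc-suc : ∀ n → allFinAsc (suc n) ≡ F.zero ∷ map F.suc (allFinAsc n)
allFinAsc-suc n = trans (cong toList (allFin-map n)) (cong (F.zero ∷_) (toList-map F.suc (Vec.allFin n)))

allFinAsc-increasing : ∀ n → AllPairs F._<_ (allFinAsc n)
allFinAsc-increasing zero = []
allFinAsc-increasing (suc n) rewrite allFinAsc-suc n =
  All.map⁺ (All.tabulate (λ _ → s≤s z≤n)) ∷ AllPairs.map⁺ (AllPairs.map s≤s (allFinAsc-increasing n))

∈-allFinAsc : (i : Fin n) → i ∈ₗ allFinAsc n
∈-allFinAsc i = ∈-toList⁺ (∈-allFin⁺ i)

member? : (R : Subset n) → Decidable (λ i → lookup R i ≡ true)
member? R i = lookup R i ≟ᵇ true

elemsAsc-∷ : ∀ x (xs : Subset n) →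
  elemsAsc (x ∷ xs) ≡ (if x then F.zero ∷ map F.suc (elemsAsc xs) else map F.suc (elemsAsc xs))
elemsAsc-∷ {n} true xs =
  trans (cong (filter (member? (true ∷ xs))) (allFinAsc-suc n))
        (cong (F.zero ∷_) (filter-map (member? (true ∷ xs)) F.suc (allFinAsc n)))
elemsAsc-∷ {n} false xs =
  trans (cong (filter (member? (false ∷ xs))) (allFinAsc-suc n))
        (filter-map (member? (false ∷ xs)) F.suc (allFinAsc n))

elemsAsc-increasing : (R : Subset n) → AllPairs F._<_ (elemsAsc R)
elemsAsc-increasing {n} R = AllPairs.filter⁺ (member? R) (allFinAsc-increasing n)

elemsDesc-decreasing : (R : Subset n) → Decreasing (elemsDesc R)
elemsDesc-decreasing R = AllPairs-reverse (elemsAsc-increasing R)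

∈-elemsAsc⁺ : ∀ {R : Subset n} {i} → i ∈ R → i ∈ₗ elemsAsc R
∈-elemsAsc⁺ {R = R} {i} i∈R = ∈-filter⁺ (member? R) (∈-allFinAsc i) ([]=⇒lookup i∈R)

∈-elemsAsc⁻ : ∀ {R : Subset n} {i} → i ∈ₗ elemsAsc R → i ∈ R
∈-elemsAsc⁻ {n} {R} {i} i∈ =
  lookup⇒[]= i R (proj₂ (∈-filter⁻ (member? R) {xs = allFinAsc n} i∈))

∈-elemsDesc⁺ : ∀ {R : Subset n} {i} → i ∈ R → i ∈ₗ elemsDesc R
∈-elemsDesc⁺ = Any.reverse⁺ ∘ ∈-elemsAsc⁺

∈-elemsDesc⁻ : ∀ {R : Subset n} {i} → i ∈ₗ elemsDesc R → i ∈ R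
∈-elemsDesc⁻ = ∈-elemsAsc⁻ ∘ Any.reverse⁻

tailCount : Subset n → ℕ → ℕ
tailCount Vec.[]   _       = 0
tailCount (x ∷ xs) zero    = if x then suc (tailCount xs 0) else tailCount xs 0
tailCount (x ∷ xs) (suc t) = tailCount xs t

countAtLeast-elemsAsc : ∀ (R : Subset n) t → countAtLeast t (elemsAsc R) ≡ tailCount R t
countAtLeast-elemsAsc Vec.[] t = refl
countAtLeast-elemsAsc (x ∷ xs) t rewrite elemsAsc-∷ x xs with x | t
... | true  | zero  = cong suc (trans (countAtLeast-zero-map-suc (elemsAsc xs)) (countAtLeast-elemsAsc xs 0))
... | false | zero  = trans (countAtLeast-zero-map-suc (elemsAsc xs)) (countAtLeast-elemsAsc xs 0)
... | true  | suc t = trans (countAtLeast-map-suc t (elemsAsc xs)) (countAtLeast-elemsAsc xs t)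
... | false | suc t = trans (countAtLeast-map-suc t (elemsAsc xs)) (countAtLeast-elemsAsc xs t)

countAtLeast-elemsDesc : ∀ (R : Subset n) t → countAtLeast t (elemsDesc R) ≡ tailCount R t
countAtLeast-elemsDesc R t = trans (countAtLeast-reverse t (elemsAsc R)) (countAtLeast-elemsAsc R t)

infix 4 _≼_
_≼_ : Subset n → Subset n → Set
A ≼ B = ∀ t → tailCount A t ℕ.≤ tailCount B t

≤G⇔≼ : (A B : Subset n) → A ≤G B ⇔ A ≼ B
≤G⇔≼ A B = mk⇔
  (λ A≤B t → subst₂ ℕ._≤_ (countAtLeast-elemsDesc A t) (countAtLeast-elemsDesc B t)
                          (GaleDesc⇒countAtLeast-≤ (elemsDesc-decreasing A) A≤B t))
  (λ A≼B → countAtLeast-≤⇒GaleDesc (elemsDesc-decreasing A) (elemsDesc-decreasing B)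
             (λ t → subst₂ ℕ._≤_ (sym (countAtLeast-elemsDesc A t)) (sym (countAtLeast-elemsDesc B t)) (A≼B t)))

tailCount-antitone : ∀ (R : Subset n) {t t′} → t ℕ.≤ t′ → tailCount R t′ ℕ.≤ tailCount R t
tailCount-antitone Vec.[]          _       = z≤n
tailCount-antitone (x ∷ xs) {zero} {zero}   _ = ≤-refl
tailCount-antitone (true ∷ xs)  {zero} {suc t′} _ = ≤-trans (tailCount-antitone xs {0} {t′} z≤n) (n≤1+n _)
tailCount-antitone (false ∷ xs) {zero} {suc t′} _ = tailCount-antitone xs {0} {t′} z≤n
tailCount-antitone (x ∷ xs) {suc t} {suc t′} t≤t′ = tailCount-antitone xs (s≤s⁻¹ t≤t′)

tailCount-gap : ∀ (R : Subset n) {t t′} → (∀ i → i ∈ R → t ℕ.≤ toℕ i → t′ ℕ.≤ toℕ i) →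
  tailCount R t ℕ.≤ tailCount R t′
tailCount-gap Vec.[] _ = z≤n
tailCount-gap R {t′ = zero} _ = tailCount-antitone R z≤n
tailCount-gap (true ∷ xs) {zero} {suc t′} gap with gap F.zero Vec.here z≤n
... | ()
tailCount-gap (false ∷ xs) {zero} {suc t′} gap =
  tailCount-gap xs {0} {t′} (λ i i∈ _ → s≤s⁻¹ (gap (F.suc i) (Vec.there i∈) z≤n))
tailCount-gap (x ∷ xs) {suc t} {suc t′} gap =
  tailCount-gap xs (λ i i∈ t≤i → s≤s⁻¹ (gap (F.suc i) (Vec.there i∈) (s≤s t≤i)))

tailCount-beyond : ∀ (R : Subset n) t → (∀ i → i ∈ R → toℕ i ℕ.< t) → tailCount R t ≡ 0
tailCount-beyond Vec.[] t _ = refl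
tailCount-beyond (true ∷ xs) zero R<0 with R<0 F.zero Vec.here
... | ()
tailCount-beyond (false ∷ xs) zero R<0 = tailCount-beyond xs 0 (λ i i∈ → contradiction (R<0 (F.suc i) (Vec.there i∈)) λ ())
tailCount-beyond (x ∷ xs) (suc t) R<t = tailCount-beyond xs t (λ i i∈ → s≤s⁻¹ (R<t (F.suc i) (Vec.there i∈)))

tailCount-remove-upTo : ∀ (R : Subset n) ℓ t → ℓ ∈ R → t ℕ.≤ toℕ ℓ → tailCount R t ≡ suc (tailCount (R - ℓ) t)
tailCount-remove-upTo (true ∷ xs) F.zero zero Vec.here _ = cong (λ ys → suc (tailCount ys 0)) (sym (p─⊥≡p xs))
tailCount-remove-upTo (true  ∷ xs) (F.suc ℓ) zero (Vec.there ℓ∈) _ = cong suc (tailCount-remove-upTo xs ℓ 0 ℓ∈ z≤n)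
tailCount-remove-upTo (false ∷ xs) (F.suc ℓ) zero (Vec.there ℓ∈) _ = tailCount-remove-upTo xs ℓ 0 ℓ∈ z≤n
tailCount-remove-upTo (x ∷ xs) (F.suc ℓ) (suc t) (Vec.there ℓ∈) t≤ℓ = tailCount-remove-upTo xs ℓ t ℓ∈ (s≤s⁻¹ t≤ℓ)

tailCount-remove-above : ∀ (R : Subset n) ℓ t → toℕ ℓ ℕ.< t → tailCount R t ≡ tailCount (R - ℓ) t
tailCount-remove-above (x ∷ xs) F.zero (suc t) _ = cong (λ ys → tailCount ys t) (sym (p─⊥≡p xs))
tailCount-remove-above (x ∷ xs) (F.suc ℓ) (suc t) ℓ<t = tailCount-remove-above xs ℓ t (s≤s⁻¹ ℓ<t)

insert-remove : ∀ {X : Subset n} {ℓ} → ℓ ∉ X → (X [ ℓ ]≔ true) - ℓ ≡ X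
insert-remove {X = true  ∷ xs} {F.zero} ℓ∉X = contradiction Vec.here ℓ∉X
insert-remove {X = false ∷ xs} {F.zero} _   = cong (false ∷_) (p─⊥≡p xs)
insert-remove {X = x ∷ xs} {F.suc ℓ} ℓ∉X = cong (x ∷_) (insert-remove (ℓ∉X ∘ Vec.there))

record AddsAt (ℓ : Fin n) (X R : Subset n) : Set where
  field
    upTo  : ∀ t → t ℕ.≤ toℕ ℓ → tailCount R t ≡ suc (tailCount X t)
    above : ∀ t → toℕ ℓ ℕ.< t → tailCount R t ≡ tailCount X t

  smaller : X ≼ R
  smaller t with t ≤? toℕ ℓ
  ... | yes t≤ℓ = ≤-trans (n≤1+n _) (≤-reflexive (sym (upTo t t≤ℓ)))
  ... | no  t≰ℓ = ≤-reflexive (sym (above t (≰⇒> t≰ℓ)))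

remove-addsAt : ∀ {R : Subset n} {ℓ} → ℓ ∈ R → AddsAt ℓ (R - ℓ) R
remove-addsAt {R = R} {ℓ} ℓ∈R = record
  { upTo  = λ t t≤ℓ → tailCount-remove-upTo R ℓ t ℓ∈R t≤ℓ
  ; above = tailCount-remove-above R ℓ
  }

insert-addsAt : ∀ {X : Subset n} {ℓ} → ℓ ∉ X → AddsAt ℓ X (X [ ℓ ]≔ true)
insert-addsAt {X = X} {ℓ} ℓ∉X = subst (λ Y → AddsAt ℓ Y (X [ ℓ ]≔ true)) (insert-remove ℓ∉X) (remove-addsAt ([]≔-updates X ℓ))

module _ {ℓ : Fin n} {X R : Subset n} (R=X+ℓ : AddsAt ℓ X R) where
  open AddsAt R=X+ℓ
  open ≤-Reasoning

  ≼-past-gap : ∀ {S t} → S ≼ R → (∀ i → i ∈ S → t ℕ.≤ toℕ i → toℕ ℓ ℕ.< toℕ i) →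
    tailCount S t ℕ.≤ tailCount X t
  ≼-past-gap {S} {t} S≼R gap with t ≤? toℕ ℓ
  ... | yes t≤ℓ = begin
    tailCount S t           ≤⟨ tailCount-gap S gap ⟩
    tailCount S (suc (toℕ ℓ)) ≤⟨ S≼R (suc (toℕ ℓ)) ⟩
    tailCount R (suc (toℕ ℓ)) ≡⟨ above (suc (toℕ ℓ)) ≤-refl ⟩
    tailCount X (suc (toℕ ℓ)) ≤⟨ tailCount-antitone X (≤-trans t≤ℓ (n≤1+n _)) ⟩
    tailCount X t           ∎
  ... | no t≰ℓ = begin
    tailCount S t ≤⟨ S≼R t ⟩
    tailCount R t ≡⟨ above t (≰⇒> t≰ℓ) ⟩
    tailCount X t ∎

  ≼-before-gap : ∀ {T t} → R ≼ T → (∀ i → i ∈ T → toℕ ℓ ℕ.≤ toℕ i → t ℕ.≤ toℕ i) →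
    tailCount X t ℕ.< tailCount T t
  ≼-before-gap {T} {t} R≼T gap with t ≤? toℕ ℓ
  ... | yes t≤ℓ = begin
    suc (tailCount X t) ≡⟨ upTo t t≤ℓ ⟨
    tailCount R t       ≤⟨ R≼T t ⟩
    tailCount T t       ∎
  ... | no t≰ℓ = begin
    suc (tailCount X t)      ≤⟨ s≤s (tailCount-antitone X (<⇒≤ (≰⇒> t≰ℓ))) ⟩
    suc (tailCount X (toℕ ℓ)) ≡⟨ upTo (toℕ ℓ) ≤-refl ⟨
    tailCount R (toℕ ℓ)       ≤⟨ R≼T (toℕ ℓ) ⟩
    tailCount T (toℕ ℓ)       ≤⟨ tailCount-gap T gap ⟩
    tailCount T t             ∎

  ⋠-without-room : ∀ {T} → (∀ i → i ∈ T → toℕ i ℕ.< toℕ ℓ) → ¬ R ≼ T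
  ⋠-without-room {T} T<ℓ R≼T with subst₂ ℕ._≤_ (upTo (toℕ ℓ) ≤-refl) (tailCount-beyond T (toℕ ℓ) T<ℓ) (R≼T (toℕ ℓ))
  ... | ()

  lower-≼⇔ : ∀ {m A S} → AddsAt m A S → toℕ m ℕ.≤ toℕ ℓ →
    (∀ i → i ∈ S → toℕ m ℕ.< toℕ i → toℕ ℓ ℕ.< toℕ i) → S ≼ R ⇔ A ≼ X
  lower-≼⇔ {m} {A} {S} S=A+m m≤ℓ gap = mk⇔ to from
    where
    module S = AddsAt S=A+m
    to : S ≼ R → A ≼ X
    to S≼R t with t ≤? toℕ m
    ... | yes t≤m = s≤s⁻¹ (subst₂ ℕ._≤_ (S.upTo t t≤m) (upTo t (≤-trans t≤m m≤ℓ)) (S≼R t))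
    ... | no t≰m = begin
      tailCount A t ≡⟨ S.above t (≰⇒> t≰m) ⟨
      tailCount S t ≤⟨ ≼-past-gap S≼R (λ i i∈S t≤i → gap i i∈S (<-≤-trans (≰⇒> t≰m) t≤i)) ⟩
      tailCount X t ∎
    from : A ≼ X → S ≼ R
    from A≼X t with t ≤? toℕ m
    ... | yes t≤m = subst₂ ℕ._≤_ (sym (S.upTo t t≤m)) (sym (upTo t (≤-trans t≤m m≤ℓ))) (s≤s (A≼X t))
    ... | no t≰m = begin
      tailCount S t ≡⟨ S.above t (≰⇒> t≰m) ⟩
      tailCount A t ≤⟨ A≼X t ⟩
      tailCount X t ≤⟨ smaller t ⟩
      tailCount R t ∎

  lower-≼⇔-unchanged : ∀ {S} → (∀ i → i ∈ S → toℕ ℓ ℕ.< toℕ i) → S ≼ R ⇔ S ≼ X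
  lower-≼⇔-unchanged ℓ<S = mk⇔
    (λ S≼R t → ≼-past-gap S≼R (λ i i∈S _ → ℓ<S i i∈S))
    (λ S≼X t → ≤-trans (S≼X t) (smaller t))

  upper-≼⇔ : ∀ {m B T} → AddsAt m B T → toℕ ℓ ℕ.≤ toℕ m →
    (∀ i → i ∈ T → toℕ ℓ ℕ.≤ toℕ i → toℕ m ℕ.≤ toℕ i) → R ≼ T ⇔ X ≼ B
  upper-≼⇔ {m} {B} {T} T=B+m ℓ≤m gap = mk⇔ to from
    where
    module T = AddsAt T=B+m
    to : R ≼ T → X ≼ B
    to R≼T t with t ≤? toℕ m
    ... | yes t≤m = s≤s⁻¹ (subst (suc (tailCount X t) ℕ.≤_) (T.upTo t t≤m)
                            (≼-before-gap R≼T (λ i i∈T ℓ≤i → ≤-trans t≤m (gap i i∈T ℓ≤i))))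
    ... | no t≰m = begin
      tailCount X t ≡⟨ above t (≤-<-trans ℓ≤m (≰⇒> t≰m)) ⟨
      tailCount R t ≤⟨ R≼T t ⟩
      tailCount T t ≡⟨ T.above t (≰⇒> t≰m) ⟩
      tailCount B t ∎
    from : X ≼ B → R ≼ T
    from X≼B t with t ≤? toℕ ℓ
    ... | yes t≤ℓ = subst₂ ℕ._≤_ (sym (upTo t t≤ℓ)) (sym (T.upTo t (≤-trans t≤ℓ ℓ≤m))) (s≤s (X≼B t))
    ... | no t≰ℓ = begin
      tailCount R t ≡⟨ above t (≰⇒> t≰ℓ) ⟩
      tailCount X t ≤⟨ X≼B t ⟩
      tailCount B t ≤⟨ T.smaller t ⟩
      tailCount T t ∎

maxBelow-just : ∀ {S : Subset n} {ℓ m} → maxBelow S ℓ ≡ just m →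
  m ∈ S × toℕ m ℕ.< toℕ ℓ × (∀ i → i ∈ S → toℕ i ℕ.< toℕ ℓ → toℕ i ℕ.≤ toℕ m)
maxBelow-just {S = S} {ℓ} eq with head-filter-just (λ i → i F.<? ℓ) (elemsDesc-decreasing S) eq
... | m∈ , m<ℓ , greatest = ∈-elemsDesc⁻ m∈ , m<ℓ , λ i i∈S i<ℓ → ≤-or-≡ (greatest (∈-elemsDesc⁺ i∈S) i<ℓ)
  where
  ≤-or-≡ : ∀ {i m : Fin n} → i ≡ m ⊎ i F.< m → toℕ i ℕ.≤ toℕ m
  ≤-or-≡ (inj₁ refl) = ≤-refl
  ≤-or-≡ (inj₂ i<m) = <⇒≤ i<m

maxBelow-nothing : ∀ {S : Subset n} {ℓ} → maxBelow S ℓ ≡ nothing → ∀ i → i ∈ S → ¬ toℕ i ℕ.< toℕ ℓ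
maxBelow-nothing {ℓ = ℓ} eq i i∈S = head-filter-nothing (λ i → i F.<? ℓ) eq (∈-elemsDesc⁺ i∈S)

minAbove-just : ∀ {T : Subset n} {ℓ m} → minAbove T ℓ ≡ just m →
  m ∈ T × toℕ ℓ ℕ.< toℕ m × (∀ i → i ∈ T → toℕ ℓ ℕ.< toℕ i → toℕ m ℕ.≤ toℕ i)
minAbove-just {T = T} {ℓ} eq with head-filter-just (λ i → ℓ F.<? i) (elemsAsc-increasing T) eq
... | m∈ , ℓ<m , least = ∈-elemsAsc⁻ m∈ , ℓ<m , λ i i∈T ℓ<i → ≡-or-≤ (least (∈-elemsAsc⁺ i∈T) ℓ<i)
  where
  ≡-or-≤ : ∀ {i m : Fin n} → i ≡ m ⊎ m F.< i → toℕ m ℕ.≤ toℕ i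
  ≡-or-≤ (inj₁ refl) = ≤-refl
  ≡-or-≤ (inj₂ m<i) = <⇒≤ m<i

minAbove-nothing : ∀ {T : Subset n} {ℓ} → minAbove T ℓ ≡ nothing → ∀ i → i ∈ T → ¬ toℕ ℓ ℕ.< toℕ i
minAbove-nothing {ℓ = ℓ} eq i i∈T = head-filter-nothing (λ i → ℓ F.<? i) eq (∈-elemsAsc⁺ i∈T)

data LowerShape (S : Subset n) (ℓ : Fin n) : Subset n → Set where
  removed : ∀ {A} m → AddsAt m A S → toℕ m ℕ.≤ toℕ ℓ →
            (∀ i → i ∈ S → toℕ m ℕ.< toℕ i → toℕ ℓ ℕ.< toℕ i) → LowerShape S ℓ A
  unchanged : (∀ i → i ∈ S → toℕ ℓ ℕ.< toℕ i) → LowerShape S ℓ S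

data UpperShape (T : Subset n) (ℓ : Fin n) : Subset n → Set where
  removed : ∀ {B} m → AddsAt m B T → toℕ ℓ ℕ.≤ toℕ m →
            (∀ i → i ∈ T → toℕ ℓ ℕ.≤ toℕ i → toℕ m ℕ.≤ toℕ i) → UpperShape T ℓ B

lookup-false⇒∉ : ∀ {S : Subset n} {ℓ} → lookup S ℓ ≡ false → ℓ ∉ S
lookup-false⇒∉ ℓ∉S ℓ∈S = contradiction (trans (sym ([]=⇒lookup ℓ∈S)) ℓ∉S) λ ()

lowerSet-shape : ∀ (S : Subset n) ℓ → LowerShape S ℓ (lowerSet S ℓ)
lowerSet-shape S ℓ with lookup S ℓ in ℓ∈?S
... | true = removed ℓ (remove-addsAt (lookup⇒[]= ℓ S ℓ∈?S)) ≤-refl (λ _ _ ℓ<i → ℓ<i)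
... | false with maxBelow S ℓ in max
...   | nothing = unchanged past-ℓ
  where
  past-ℓ : ∀ i → i ∈ S → toℕ ℓ ℕ.< toℕ i
  past-ℓ i i∈S with F.<-cmp i ℓ
  ... | tri< i<ℓ _ _ = contradiction i<ℓ (maxBelow-nothing max i i∈S)
  ... | tri≈ _ refl _ = contradiction i∈S (lookup-false⇒∉ ℓ∈?S)
  ... | tri> _ _ ℓ<i = ℓ<i
...   | just m with maxBelow-just {S = S} max
...     | m∈S , m<ℓ , below-ℓ⇒≤m = removed m (remove-addsAt m∈S) (<⇒≤ m<ℓ) past-ℓ
  where
  past-ℓ : ∀ i → i ∈ S → toℕ m ℕ.< toℕ i → toℕ ℓ ℕ.< toℕ i
  past-ℓ i i∈S m<i with F.<-cmp i ℓ
  ... | tri< i<ℓ _ _ = contradiction (below-ℓ⇒≤m i i∈S i<ℓ) (<⇒≱ m<i)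
  ... | tri≈ _ refl _ = contradiction i∈S (lookup-false⇒∉ ℓ∈?S)
  ... | tri> _ _ ℓ<i = ℓ<i

upperSet-shape : ∀ (T : Subset n) ℓ → ¬ (∀ i → i ∈ T → toℕ i ℕ.< toℕ ℓ) → UpperShape T ℓ (upperSet T ℓ)
upperSet-shape T ℓ T≮ℓ with lookup T ℓ in ℓ∈?T
... | true = removed ℓ (remove-addsAt (lookup⇒[]= ℓ T ℓ∈?T)) ≤-refl (λ _ _ ℓ≤i → ℓ≤i)
... | false with minAbove T ℓ in min
...   | nothing = contradiction below-ℓ T≮ℓ
  where
  below-ℓ : ∀ i → i ∈ T → toℕ i ℕ.< toℕ ℓ
  below-ℓ i i∈T with F.<-cmp i ℓ
  ... | tri< i<ℓ _ _ = i<ℓ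
  ... | tri≈ _ refl _ = contradiction i∈T (lookup-false⇒∉ ℓ∈?T)
  ... | tri> _ _ ℓ<i = contradiction ℓ<i (minAbove-nothing min i i∈T)
...   | just m with minAbove-just {T = T} min
...     | m∈T , ℓ<m , above-ℓ⇒m≤ = removed m (remove-addsAt m∈T) (<⇒≤ ℓ<m) from-ℓ
  where
  from-ℓ : ∀ i → i ∈ T → toℕ ℓ ℕ.≤ toℕ i → toℕ m ℕ.≤ toℕ i
  from-ℓ i i∈T ℓ≤i with F.<-cmp ℓ i
  ... | tri< ℓ<i _ _ = above-ℓ⇒m≤ i i∈T ℓ<i
  ... | tri≈ _ refl _ = contradiction i∈T (lookup-false⇒∉ ℓ∈?T)
  ... | tri> _ _ i<ℓ = contradiction ℓ≤i (<⇒≱ i<ℓ)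

LowerShape-≼⇔ : ∀ {S X R A : Subset n} {ℓ} → AddsAt ℓ X R → LowerShape S ℓ A → S ≼ R ⇔ A ≼ X
LowerShape-≼⇔ R=X+ℓ (removed m S=A+m m≤ℓ gap) = lower-≼⇔ R=X+ℓ S=A+m m≤ℓ gap
LowerShape-≼⇔ R=X+ℓ (unchanged ℓ<S)          = lower-≼⇔-unchanged R=X+ℓ ℓ<S

UpperShape-≼⇔ : ∀ {T X R B : Subset n} {ℓ} → AddsAt ℓ X R → UpperShape T ℓ B → R ≼ T ⇔ X ≼ B
UpperShape-≼⇔ R=X+ℓ (removed m T=B+m ℓ≤m gap) = upper-≼⇔ R=X+ℓ T=B+m ℓ≤m gap

feasible⇔ : ∀ {S T X R A B : Subset n} {ℓ} → AddsAt ℓ X R → LowerShape S ℓ A → UpperShape T ℓ B →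
  Feasible S T R ⇔ ((A ≤G X) × (X ≤G B))
feasible⇔ {S = S} {T} {X} {R} {A} {B} R=X+ℓ lower upper =
  ⇔.trans (≤G⇔≼ S R ×-⇔ ≤G⇔≼ R T)
  (⇔.trans (LowerShape-≼⇔ R=X+ℓ lower ×-⇔ UpperShape-≼⇔ R=X+ℓ upper)
           (⇔.sym (≤G⇔≼ A X ×-⇔ ≤G⇔≼ X B)))

nonLoop⇒reaches-ℓ : ∀ {S T : Subset n} {ℓ} → ¬ IsLoop S T ℓ → ¬ (∀ i → i ∈ T → toℕ i ℕ.< toℕ ℓ)
nonLoop⇒reaches-ℓ {T = T} nonLoop T<ℓ = nonLoop λ R (_ , R≤T) ℓ∈R →
  ⋠-without-room (remove-addsAt ℓ∈R) T<ℓ (Equivalence.to (≤G⇔≼ R T) R≤T)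

proposition3p5 : (n : ℕ) (S T : Subset n) (ℓ : Fin n) → S ≤G T → ¬ IsLoop S T ℓ →
    (lowerSet S ℓ ≤G upperSet T ℓ) ×
    ((X : Subset n) → ℓ ∉ X →
      (ContractionFeasible S T ℓ X ⇔ ((lowerSet S ℓ ≤G X) × (X ≤G upperSet T ℓ))))
proposition3p5 n S T ℓ _ nonLoop = A≤B , λ X ℓ∉X → mk⇔ contracted (extended ℓ∉X)
  where
  A = lowerSet S ℓ
  B = upperSet T ℓ

  feasible⇔′ : ∀ {X R} → AddsAt ℓ X R → Feasible S T R ⇔ ((A ≤G X) × (X ≤G B))
  feasible⇔′ R=X+ℓ = feasible⇔ R=X+ℓ (lowerSet-shape S ℓ) (upperSet-shape T ℓ (nonLoop⇒reaches-ℓ {S = S} nonLoop))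

  contracted : ∀ {X} → ContractionFeasible S T ℓ X → (A ≤G X) × (X ≤G B)
  contracted (R , R-feasible , ℓ∈R , refl) = Equivalence.to (feasible⇔′ (remove-addsAt ℓ∈R)) R-feasible

  extended : ∀ {X} → ℓ ∉ X → (A ≤G X) × (X ≤G B) → ContractionFeasible S T ℓ X
  extended {X} ℓ∉X A≤X≤B =
    X [ ℓ ]≔ true , Equivalence.from (feasible⇔′ (insert-addsAt ℓ∉X)) A≤X≤B ,
    []≔-updates X ℓ , sym (insert-remove ℓ∉X)

  A≤B : A ≤G B
  A≤B = Equivalence.from (≤G⇔≼ A B) λ t → decidable-stable (_ ≤? _) λ A≰B →
    nonLoop λ R R-feasible ℓ∈R → A≰B (through (R - ℓ) (contracted (R , R-feasible , ℓ∈R , refl)) t)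
    where
    through : ∀ X → (A ≤G X) × (X ≤G B) → A ≼ B
    through X (A≤X , X≤B) t = ≤-trans (Equivalence.to (≤G⇔≼ A X) A≤X t) (Equivalence.to (≤G⇔≼ X B) X≤B t)
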